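{- Work in ordinary first-order logic $\mathcal{L}_\omega^\omega$. If $\mathfrak{A}$ and $\mathfrak{B}$ are two finite models of different cardinalities, then $\mathsf{Cd}_\omega^\omega(\mathrm{Th}(\mathfrak{A}),\mathrm{Th}(\mathfrak{B}))=\infty$.
   Context: $\mathcal{L}_\omega^\omega$: languages are sets of relation symbols of finite rank (no function or constant symbols), with equality and variables $v_i$, $i<\omega$; formulas built from $v_i=v_j$ and atomic formulas by $\land,\lnot,\exists v_i$; models are nonempty sets with relations; standard satisfaction. $\mathrm{Th}(\mathfrak{M})$ is the set of formulas of the language of $\mathfrak M$ true in $\mathfrak M$ (true = satisfied under every assignment). A theory is a set of formulas of a language; $T\models\varphi$ iff $\varphi$ holds in every model of $T$. $T\sqsubseteq T'$ means every formula of $T$'s language is a formula of $T'$'s language and for such $\varphi$, $T'\models\varphi\iff T\models\varphi$. $T\leadsto T'$ iff the language of $T'$ is the language of $T$ together with one relation symbol, and $T\sqsubseteq T'$; $T\sim T'$ iff $T\leadsto T'$ or $T'\leadsto T$. A translation maps $v_i=v_j$ to itself and commutes with $\lnot,\land,\exists v_i$; it is an interpretation of $T$ into $T'$ if theorems of $T$ go to theorems of $T'$. $T,T'$ are definitionally equivalent ($\equiv_\Delta$) if there are interpretations $tr$ of $T$ into $T'$ and $tr'$ of $T'$ into $T$ with $T\models tr'(tr(\varphi))\leftrightarrow\varphi$ and $T'\models tr(tr'(\psi))\leftrightarrow\psi$ for all formulas $\varphi,\psi$. The conceptual distance $\mathsf{Cd}_\omega^\omega(T,T')$ is the least $k$ such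 that there is a finite chain of theories $T=T_0,\dots,T_m=T'$ with each consecutive pair related by $\equiv_\Delta$ or by $\sim$, exactly $k$ of the steps being $\sim$-steps; it is $\infty$ if no such chain exists. -}

module Defs where

open import Data.Nat using (ℕ; zero; suc)
open import Data.Nat.Base using (_≡ᵇ_)
open import Data.Bool using (if_then_else_)
open import Data.Fin using (Fin)
open import Data.Product using (Σ; Σ-syntax; _×_; _,_; proj₁)
open import Data.Sum using (_⊎_)
open import Data.Unit using (⊤)
open import Relation.Nullary using (¬_)
open import Relation.Binary.PropositionalEquality using (_≡_)
open import Function using (_∘_)

-- First-order logic L^ω_ω over an arbitrary universe of relation symbols
-- `Sym`, each symbol having a finite rank.  A *language* is a subset of Sym.
module FOL (Sym : Set) (rank : Sym → ℕ) where

  Language : Set₁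
  Language = Sym → Set

  data Formula : Set where
    _≐_  : ℕ → ℕ → Formula
    rel  : (R : Sym) → (Fin (rank R) → ℕ) → Formula
    _∧'_ : Formula → Formula → Formula
    ¬'_  : Formula → Formula
    ∃'   : ℕ → Formula → Formula

  InLang : Language → Formula → Set
  InLang L (i ≐ j)   = ⊤
  InLang L (rel R x) = L R
  InLang L (φ ∧' ψ)  = InLang L φ × InLang L ψ
  InLang L (¬' φ)    = InLang L φ
  InLang L (∃' i φ)  = InLang L φ

  _↔'_ : Formula → Formula → Formula
  φ ↔' ψ = (¬' (φ ∧' (¬' ψ))) ∧' (¬' (ψ ∧' (¬' φ)))

  record Structure : Set₁ where
    field
      Carrier : Set
      point   : Carrier
      Rel     : (R : Sym) → (Fin (rank R) → Carrier) → Set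
  open Structure public

  update : {A : Set} → (ℕ → A) → ℕ → A → (ℕ → A)
  update s i a k = if k ≡ᵇ i then a else s k

  Sat : (M : Structure) → Formula → (ℕ → Carrier M) → Set
  Sat M (i ≐ j)   s = s i ≡ s j
  Sat M (rel R x) s = Rel M R (s ∘ x)
  Sat M (φ ∧' ψ)  s = Sat M φ s × Sat M ψ s
  Sat M (¬' φ)    s = ¬ Sat M φ s
  Sat M (∃' i φ)  s = Σ (Carrier M) (λ a → Sat M φ (update s i a))

  True : Structure → Formula → Set
  True M φ = (s : ℕ → Carrier M) → Sat M φ s

  record Theory : Set₁ where
    field
      Lang  : Language
      Ax    : Formula → Set
      ax-in : ∀ {φ} → Ax φ → InLang Lang φ
  open Theory public

  ModelOf : Theory → Structure → Set
  ModelOf T M = ∀ φ → Ax T φ → True M φ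

  _⊨_ : Theory → Formula → Set₁
  T ⊨ φ = (M : Structure) → ModelOf T M → True M φ

  Th : Language → Structure → Theory
  Th L M = record { Lang = L ; Ax = λ φ → InLang L φ × True M φ ; ax-in = proj₁ }

  _⊑_ : Theory → Theory → Set₁
  T ⊑ T' = ((φ : Formula) → InLang (Lang T) φ → InLang (Lang T') φ)
         × ((φ : Formula) → InLang (Lang T) φ → ((T' ⊨ φ → T ⊨ φ) × (T ⊨ φ → T' ⊨ φ)))

  _⇝_ : Theory → Theory → Set₁
  T ⇝ T' = Σ[ R ∈ Sym ] (¬ Lang T R)
         × ((S : Sym) → ((Lang T' S → Lang T S ⊎ S ≡ R) × (Lang T S ⊎ S ≡ R → Lang T' S)))
         × T ⊑ T'

  _∼_ : Theory → Theory → Set₁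
  T ∼ T' = T ⇝ T' ⊎ T' ⇝ T

  Translation : Set
  Translation = (R : Sym) → (Fin (rank R) → ℕ) → Formula

  apply : Translation → Formula → Formula
  apply tr (i ≐ j)   = i ≐ j
  apply tr (rel R x) = tr R x
  apply tr (φ ∧' ψ)  = apply tr φ ∧' apply tr ψ
  apply tr (¬' φ)    = ¬' apply tr φ
  apply tr (∃' i φ)  = ∃' i (apply tr φ)

  IsInterpretation : Theory → Theory → Translation → Set₁
  IsInterpretation T T' tr =
      ((φ : Formula) → InLang (Lang T) φ → InLang (Lang T') (apply tr φ))
    × ((φ : Formula) → InLang (Lang T) φ → T ⊨ φ → T' ⊨ apply tr φ)

  _≡Δ_ : Theory → Theory → Set₁
  T ≡Δ T' = Σ[ tr ∈ Translation ] Σ[ tr' ∈ Translation ]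
      IsInterpretation T T' tr × IsInterpretation T' T tr'
    × ((φ : Formula) → InLang (Lang T) φ → T ⊨ (apply tr' (apply tr φ) ↔' φ))
    × ((ψ : Formula) → InLang (Lang T') ψ → T' ⊨ (apply tr (apply tr' ψ) ↔' ψ))

  data Chain : Theory → Theory → ℕ → Set₁ where
    done  : ∀ {T} → Chain T T zero
    stepΔ : ∀ {T T₁ T' k} → T ≡Δ T₁ → Chain T₁ T' k → Chain T T' k
    step∼ : ∀ {T T₁ T' k} → T ∼ T₁ → Chain T₁ T' k → Chain T T' (suc k)

  Cd≡∞ : Theory → Theory → Set₁
  Cd≡∞ T T' = (k : ℕ) → ¬ Chain T T' k

-- Formulas built from equalities alone belong to every language and are fixed
-- by every translation, so each step of a chain, whether a definitional
-- equivalence or the addition of one relation symbol, preserves which of them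
-- are theorems.  Along a chain from Th(𝔄) to Th(𝔅) the two structures must
-- therefore agree on the sentences "there are at least k elements", and for
-- finite structures these determine the cardinality.

module Submission where

open import Defs
open import Data.Nat using (ℕ)
open import Data.Fin using (Fin)
open import Relation.Binary.PropositionalEquality using (_≢_)
open import Function.Bundles using (_↔_)

open import Data.Bool using (true; false)
open import Data.Empty using (⊥; ⊥-elim)
open import Data.Fin using (zero; suc)
open import Data.Fin.Properties using (0≢1+n; suc-injective; injective⇒≤; inject≤-injective)
open import Data.Nat using (zero; suc; _≤_; _≡ᵇ_)
open import Data.Nat.Properties using (≤-refl; ≤-antisym; n≤1+n; ≤-trans; >⇒≢; ≡ᵇ⇒≡; ≡⇒≡ᵇ)
open import Data.Product using (Σ; _×_; _,_; proj₂)
open import Data.Sum using (inj₁; inj₂)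
open import Data.Unit using (⊤; tt)
open import Function using (_∘_)
open import Function.Bundles using (_⇔_; _↣_; mk⇔; mk↣; Equivalence; Injection)
open import Function.Construct.Composition using (_⇔-∘_; _↣-∘_)
open import Function.Construct.Identity using (⇔-id)
open import Function.Construct.Symmetry using (⇔-sym; ↔-sym)
open import Function.Definitions using (Injective)
open import Function.Properties.Inverse using (↔⇒↣)
open import Relation.Binary.PropositionalEquality using (_≡_; _≗_; refl; sym; trans; cong; cong₂; subst)

Fin↣⇔≤ : {A : Set} {n k : ℕ} → A ↔ Fin n → (Fin k ↣ A) ⇔ k ≤ n
Fin↣⇔≤ A↔n = mk⇔
  (λ k↣A → injective⇒≤ (Injection.injective (↔⇒↣ A↔n ↣-∘ k↣A)))
  (λ k≤n → ↔⇒↣ (↔-sym A↔n) ↣-∘ mk↣ (inject≤-injective k≤n k≤n _ _))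

injective-resp-≗ : {A B : Set} {f g : A → B} → f ≗ g → Injective _≡_ _≡_ f → Injective _≡_ _≡_ g
injective-resp-≗ f≗g f-inj {i} {j} gi≡gj = f-inj (trans (f≗g i) (trans gi≡gj (sym (f≗g j))))

module _ {Sym : Set} {rank : Sym → ℕ} where
  open FOL Sym rank

  Pure : Formula → Set
  Pure (i ≐ j)   = ⊤
  Pure (rel R x) = ⊥
  Pure (φ ∧' ψ)  = Pure φ × Pure ψ
  Pure (¬' φ)    = Pure φ
  Pure (∃' i φ)  = Pure φ

  Pure⇒InLang : (L : Language) (φ : Formula) → Pure φ → InLang L φ
  Pure⇒InLang L (i ≐ j)  _       = tt
  Pure⇒InLang L (φ ∧' ψ) (p , q) = Pure⇒InLang L φ p , Pure⇒InLang L ψ q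
  Pure⇒InLang L (¬' φ)   p       = Pure⇒InLang L φ p
  Pure⇒InLang L (∃' i φ) p       = Pure⇒InLang L φ p

  apply-pure : (tr : Translation) (φ : Formula) → Pure φ → apply tr φ ≡ φ
  apply-pure tr (i ≐ j)  _       = refl
  apply-pure tr (φ ∧' ψ) (p , q) = cong₂ _∧'_ (apply-pure tr φ p) (apply-pure tr ψ q)
  apply-pure tr (¬' φ)   p       = cong ¬'_ (apply-pure tr φ p)
  apply-pure tr (∃' i φ) p       = cong (∃' i) (apply-pure tr φ p)

  PureEquivalent : Theory → Theory → Set₁
  PureEquivalent T T' = (φ : Formula) → Pure φ → T ⊨ φ ⇔ T' ⊨ φ

  interpretation-preserves-pure : {T T' : Theory} {tr : Translation} → IsInterpretation T T' tr →
    (φ : Formula) → Pure φ → T ⊨ φ → T' ⊨ φ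
  interpretation-preserves-pure {T} {T'} {tr} (_ , preserves) φ p T⊨φ =
    subst (T' ⊨_) (apply-pure tr φ p) (preserves φ (Pure⇒InLang (Lang T) φ p) T⊨φ)

  ≡Δ⇒PureEquivalent : {T T' : Theory} → T ≡Δ T' → PureEquivalent T T'
  ≡Δ⇒PureEquivalent {T} {T'} (tr , tr' , tr-interprets , tr'-interprets , _) φ p = mk⇔
    (interpretation-preserves-pure {T} {T'} {tr} tr-interprets φ p)
    (interpretation-preserves-pure {T'} {T} {tr'} tr'-interprets φ p)

  ⊑⇒PureEquivalent : {T T' : Theory} → T ⊑ T' → PureEquivalent T T'
  ⊑⇒PureEquivalent {T} (_ , conservative) φ p with conservative φ (Pure⇒InLang (Lang T) φ p)
  ... | reflect , preserve = mk⇔ preserve reflect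

  ∼⇒PureEquivalent : {T T' : Theory} → T ∼ T' → PureEquivalent T T'
  ∼⇒PureEquivalent {T} {T'} (inj₁ (_ , _ , _ , T⊑T')) = ⊑⇒PureEquivalent {T} {T'} T⊑T'
  ∼⇒PureEquivalent {T} {T'} (inj₂ (_ , _ , _ , T'⊑T)) φ p = ⇔-sym (⊑⇒PureEquivalent {T'} {T} T'⊑T φ p)

  Chain⇒PureEquivalent : {T T' : Theory} {k : ℕ} → Chain T T' k → PureEquivalent T T'
  Chain⇒PureEquivalent {T} done φ p = ⇔-id (T ⊨ φ)
  Chain⇒PureEquivalent {T} (stepΔ {T₁ = T₁} e c) φ p =
    Chain⇒PureEquivalent c φ p ⇔-∘ ≡Δ⇒PureEquivalent {T} {T₁} e φ p
  Chain⇒PureEquivalent {T} (step∼ {T₁ = T₁} e c) φ p =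
    Chain⇒PureEquivalent c φ p ⇔-∘ ∼⇒PureEquivalent {T} {T₁} e φ p

  Th-⊨⇔True : (L : Language) (M : Structure) (φ : Formula) → InLang L φ → Th L M ⊨ φ ⇔ True M φ
  Th-⊨⇔True L M φ φ∈L = mk⇔
    (λ Th⊨φ → Th⊨φ M (λ _ → proj₂))
    (λ M⊨φ N N⊨Th → N⊨Th φ (φ∈L , M⊨φ))

  Chain⇒same-pure-truths : (LA LB : Language) (𝔄 𝔅 : Structure) {k : ℕ} →
    Chain (Th LA 𝔄) (Th LB 𝔅) k → (φ : Formula) → Pure φ → True 𝔄 φ ⇔ True 𝔅 φ
  Chain⇒same-pure-truths LA LB 𝔄 𝔅 c φ p =
    (Th-⊨⇔True LB 𝔅 φ (Pure⇒InLang LB φ p) ⇔-∘ Chain⇒PureEquivalent c φ p)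
      ⇔-∘ ⇔-sym (Th-⊨⇔True LA 𝔄 φ (Pure⇒InLang LA φ p))

  -- var k lists v_{k-1}, …, v_0, the order in which exists k binds them.
  var : (k : ℕ) → Fin k → ℕ
  var (suc k) zero    = k
  var (suc k) (suc j) = var k j

  distinctFrom : ℕ → ℕ → Formula
  distinctFrom x zero    = 0 ≐ 0
  distinctFrom x (suc k) = (¬' (x ≐ k)) ∧' distinctFrom x k

  allDistinct : ℕ → Formula
  allDistinct zero    = 0 ≐ 0
  allDistinct (suc k) = distinctFrom k k ∧' allDistinct k

  exists : ℕ → Formula → Formula
  exists zero    ψ = ψ
  exists (suc k) ψ = ∃' k (exists k ψ)

  atLeast : ℕ → Formula
  atLeast k = exists k (allDistinct k)

  Pure-distinctFrom : (x k : ℕ) → Pure (distinctFrom x k)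
  Pure-distinctFrom x zero    = tt
  Pure-distinctFrom x (suc k) = tt , Pure-distinctFrom x k

  Pure-allDistinct : (k : ℕ) → Pure (allDistinct k)
  Pure-allDistinct zero    = tt
  Pure-allDistinct (suc k) = Pure-distinctFrom k k , Pure-allDistinct k

  Pure-exists : (k : ℕ) (ψ : Formula) → Pure ψ → Pure (exists k ψ)
  Pure-exists zero    ψ p = p
  Pure-exists (suc k) ψ p = Pure-exists k ψ p

  Pure-atLeast : (k : ℕ) → Pure (atLeast k)
  Pure-atLeast k = Pure-exists k (allDistinct k) (Pure-allDistinct k)

  update-same : {A : Set} (s : ℕ → A) (i : ℕ) (a : A) → update s i a i ≡ a
  update-same s i a with i ≡ᵇ i | ≡⇒≡ᵇ i i refl
  ... | true  | _  = refl
  ... | false | ()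

  update-other : {A : Set} (s : ℕ → A) {i : ℕ} (a : A) {j : ℕ} → j ≢ i → update s i a j ≡ s j
  update-other s {i} a {j} j≢i with j ≡ᵇ i | ≡ᵇ⇒≡ j i
  ... | false | _   = refl
  ... | true  | j≡i = ⊥-elim (j≢i (j≡i tt))

  module _ (M : Structure) where

    updates : (ℕ → Carrier M) → (k : ℕ) → (Fin k → Carrier M) → ℕ → Carrier M
    updates s zero    f = s
    updates s (suc k) f = updates (update s k (f zero)) k (f ∘ suc)

    updates-beyond : (s : ℕ → Carrier M) (k : ℕ) (f : Fin k → Carrier M) {i : ℕ} → k ≤ i →
      updates s k f i ≡ s i
    updates-beyond s zero    f k≤i = refl
    updates-beyond s (suc k) f k<i =
      trans (updates-beyond (update s k (f zero)) k (f ∘ suc) (≤-trans (n≤1+n k) k<i))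
            (update-other s (f zero) (>⇒≢ k<i))

    updates-var : (s : ℕ → Carrier M) (k : ℕ) (f : Fin k → Carrier M) → updates s k f ∘ var k ≗ f
    updates-var s (suc k) f zero    =
      trans (updates-beyond (update s k (f zero)) k (f ∘ suc) ≤-refl) (update-same s k (f zero))
    updates-var s (suc k) f (suc j) = updates-var (update s k (f zero)) k (f ∘ suc) j

    Sat-exists⁻ : (k : ℕ) (ψ : Formula) (s : ℕ → Carrier M) → Sat M (exists k ψ) s →
      Σ (Fin k → Carrier M) (λ f → Sat M ψ (updates s k f))
    Sat-exists⁻ zero    ψ s h = (λ ()) , h
    Sat-exists⁻ (suc k) ψ s (a , h) with Sat-exists⁻ k ψ (update s k a) h
    ... | f , h' = (λ { zero → a ; (suc i) → f i }) , h'

    Sat-exists⁺ : (k : ℕ) (ψ : Formula) (s : ℕ → Carrier M) (f : Fin k → Carrier M) →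
      Sat M ψ (updates s k f) → Sat M (exists k ψ) s
    Sat-exists⁺ zero    ψ s f h = h
    Sat-exists⁺ (suc k) ψ s f h = f zero , Sat-exists⁺ k ψ (update s k (f zero)) (f ∘ suc) h

    Sat-distinctFrom⁻ : (x k : ℕ) (t : ℕ → Carrier M) → Sat M (distinctFrom x k) t →
      (j : Fin k) → t x ≢ t (var k j)
    Sat-distinctFrom⁻ x (suc k) t (x≢k , _) zero    = x≢k
    Sat-distinctFrom⁻ x (suc k) t (_ , h)   (suc j) = Sat-distinctFrom⁻ x k t h j

    Sat-distinctFrom⁺ : (x k : ℕ) (t : ℕ → Carrier M) → ((j : Fin k) → t x ≢ t (var k j)) →
      Sat M (distinctFrom x k) t
    Sat-distinctFrom⁺ x zero    t h = refl
    Sat-distinctFrom⁺ x (suc k) t h = h zero , Sat-distinctFrom⁺ x k t (h ∘ suc)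

    Sat-allDistinct⁻ : (k : ℕ) (t : ℕ → Carrier M) → Sat M (allDistinct k) t →
      Injective _≡_ _≡_ (t ∘ var k)
    Sat-allDistinct⁻ (suc k) t _ {zero}  {zero}  _  = refl
    Sat-allDistinct⁻ (suc k) t (h , _) {zero}  {suc j} eq = ⊥-elim (Sat-distinctFrom⁻ k k t h j eq)
    Sat-allDistinct⁻ (suc k) t (h , _) {suc i} {zero}  eq = ⊥-elim (Sat-distinctFrom⁻ k k t h i (sym eq))
    Sat-allDistinct⁻ (suc k) t (_ , h) {suc i} {suc j} eq = cong suc (Sat-allDistinct⁻ k t h eq)

    Sat-allDistinct⁺ : (k : ℕ) (t : ℕ → Carrier M) → Injective _≡_ _≡_ (t ∘ var k) →
      Sat M (allDistinct k) t
    Sat-allDistinct⁺ zero    t inj = refl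
    Sat-allDistinct⁺ (suc k) t inj =
      Sat-distinctFrom⁺ k k t (λ j → 0≢1+n ∘ inj) , Sat-allDistinct⁺ k t (suc-injective ∘ inj)

    Sat-atLeast⇔ : (k : ℕ) (s : ℕ → Carrier M) → Sat M (atLeast k) s ⇔ (Fin k ↣ Carrier M)
    Sat-atLeast⇔ k s = mk⇔
      (λ h → let (f , distinct) = Sat-exists⁻ k (allDistinct k) s h in
        mk↣ (injective-resp-≗ (updates-var s k f) (Sat-allDistinct⁻ k (updates s k f) distinct)))
      (λ f↣ → let f = Injection.to f↣ in
        Sat-exists⁺ k (allDistinct k) s f (Sat-allDistinct⁺ k (updates s k f)
          (injective-resp-≗ (sym ∘ updates-var s k f) (Injection.injective f↣))))

    True-atLeast⇔≤ : {n : ℕ} → Carrier M ↔ Fin n → (k : ℕ) → True M (atLeast k) ⇔ k ≤ n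
    True-atLeast⇔≤ M↔n k = Fin↣⇔≤ M↔n ⇔-∘ mk⇔
      (λ M⊨atLeast → Equivalence.to (Sat-atLeast⇔ k _) (M⊨atLeast (λ _ → point M)))
      (λ k↣M s → Equivalence.from (Sat-atLeast⇔ k s) k↣M)

corollary4p12 : (Sym : Set) (rank : Sym → ℕ) → let open FOL Sym rank in
    (LA LB : Language) (𝔄 𝔅 : Structure) (n m : ℕ) →
    Carrier 𝔄 ↔ Fin n → Carrier 𝔅 ↔ Fin m → n ≢ m →
    Cd≡∞ (Th LA 𝔄) (Th LB 𝔅)
corollary4p12 Sym rank LA LB 𝔄 𝔅 n m 𝔄↔n 𝔅↔m n≢m k chain =
  n≢m (≤-antisym (Equivalence.to (≤n⇔≤m n) ≤-refl) (Equivalence.from (≤n⇔≤m m) ≤-refl))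
  where
    ≤n⇔≤m : (j : ℕ) → j ≤ n ⇔ j ≤ m
    ≤n⇔≤m j =
      (True-atLeast⇔≤ 𝔅 𝔅↔m j ⇔-∘ Chain⇒same-pure-truths LA LB 𝔄 𝔅 chain (atLeast j) (Pure-atLeast j))
        ⇔-∘ ⇔-sym (True-atLeast⇔≤ 𝔄 𝔄↔n j)
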